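{- Let $G$ be a finite acyclic directed graph and let $\preceq$ be a linear order on its edge set $E(G)$ (with strict part $\prec$). Then $\preceq$ satisfies conditions $(U_1)$, $(U_2)$, $(U_3)$ below if and only if it satisfies conditions $(Q_1)$, $(Q_2)$ below. $(U_1)$ For edges $e_1,e_2$, $e_1\to e_2$ implies $e_1\prec e_2$. $(U_2)$ For every vertex $v$, $\overline{I(v)}\cap\overline{O(v)}=\emptyset$ and $\overline{E(v)}=\overline{I(v)}\sqcup\overline{O(v)}$. $(U_3)$ For any two vertices $v_1,v_2$: $I(v_1)\cap\overline{I(v_2)}\neq\emptyset$ implies $\overline{I(v_1)}\subseteq\overline{I(v_2)}$, and $O(v_1)\cap\overline{O(v_2)}\neq\emptyset$ implies $\overline{O(v_1)}\subseteq\overline{O(v_2)}$. $(Q_1)$ For edges $e_1,e_2$, $e_1\to e_2$ implies $e_1\prec e_2$. $(Q_2)$ If $e_1\prec e\prec e_2$ and $e_1,e_2$ are adjacent (share an endpoint), then: if $t(e_1)=t(e_2)=v$, then $I(t(e))\subseteq\overline{I(v)}$; if $s(e_1)=s(e_2)=v$, then $O(s(e))\subseteq\overline{O(v)}$; if $t(e_1)=s(e_2)=v$, then either $I(t(e))\subseteq\overline{I(v)}$ or $O(s(e))\subseteq\overline{O(v)}$.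
   Context: Directed graphs are finite and may have multiple edges; each edge $e$ has a source $s(e)$ and a target $t(e)$. For a vertex $v$, $I(v)$ is the set of incoming edges (edges with target $v$), $O(v)$ the set of outgoing edges (edges with source $v$), and $E(v)=I(v)\cup O(v)$. For edges $e_1,e_2$, $e_1\to e_2$ means there is a directed path starting with the edge $e_1$ and ending with the edge $e_2$ (the reachable order). For a subset $X$ of a finite linearly ordered set $(S,\preceq)$, $\overline{X}=\{y\in S: \min X\preceq y\preceq \max X\}$ is its convex hull (empty if $X$ is empty). -}

module Defs where

open import Data.Nat using (ℕ)
open import Data.Fin using (Fin)
open import Data.Product using (Σ; ∃; _×_; _,_)
open import Data.Sum using (_⊎_)
open import Relation.Nullary using (¬_)
open import Relation.Binary.PropositionalEquality using (_≡_; _≢_)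
open import Relation.Binary.Structures using (IsTotalOrder)

record Digraph : Set where
  field
    nV : ℕ
    nE : ℕ
    s  : Fin nE → Fin nV
    t  : Fin nE → Fin nV

module _ (G : Digraph) where
  open Digraph G

  Vertex : Set
  Vertex = Fin nV

  Edge : Set
  Edge = Fin nE

  -- e₁ → e₂ : there is a directed path (of at least two edges, counting
  -- e₁ and e₂) starting with e₁ and ending with e₂.
  data Reach : Edge → Edge → Set where
    step  : ∀ {e₁ e₂} → t e₁ ≡ s e₂ → Reach e₁ e₂
    trans : ∀ {e₁ e₂ e₃} → Reach e₁ e₂ → Reach e₂ e₃ → Reach e₁ e₃

  -- acyclic: no directed cycle (a cycle through e is a path from e back to e;
  -- loops are cycles of length one and are covered by 'step').
  Acyclic : Set
  Acyclic = ∀ e → ¬ Reach e e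

  EdgeSet : Set₁
  EdgeSet = Edge → Set

  I : Vertex → EdgeSet
  I v e = t e ≡ v

  O : Vertex → EdgeSet
  O v e = s e ≡ v

  E : Vertex → EdgeSet
  E v e = I v e ⊎ O v e

  _⊆_ : EdgeSet → EdgeSet → Set
  X ⊆ Y = ∀ e → X e → Y e

  module Ordered (_≼_ : Edge → Edge → Set) where

    _≺_ : Edge → Edge → Set
    a ≺ b = a ≼ b × a ≢ b

    -- convex hull: y lies between some element and some element of X
    -- (for a linear order this is exactly min X ≼ y ≼ max X; empty if X is)
    Hull : EdgeSet → EdgeSet
    Hull X y = Σ Edge λ a → Σ Edge λ b → X a × X b × a ≼ y × y ≼ b

    U₁ : Set
    U₁ = ∀ e₁ e₂ → Reach e₁ e₂ → e₁ ≺ e₂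

    U₂ : Set
    U₂ = ∀ v → (∀ e → ¬ (Hull (I v) e × Hull (O v) e))
             × (∀ e → Hull (E v) e → Hull (I v) e ⊎ Hull (O v) e)
             × (∀ e → Hull (I v) e ⊎ Hull (O v) e → Hull (E v) e)

    U₃ : Set
    U₃ = ∀ v₁ v₂ →
           ((Σ Edge λ e → I v₁ e × Hull (I v₂) e) → Hull (I v₁) ⊆ Hull (I v₂))
         × ((Σ Edge λ e → O v₁ e × Hull (O v₂) e) → Hull (O v₁) ⊆ Hull (O v₂))

    Q₁ : Set
    Q₁ = ∀ e₁ e₂ → Reach e₁ e₂ → e₁ ≺ e₂

    Q₂ : Set
    Q₂ = ∀ e₁ e e₂ → e₁ ≺ e → e ≺ e₂ →
           (∀ v → t e₁ ≡ v → t e₂ ≡ v → I (t e) ⊆ Hull (I v))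
         × (∀ v → s e₁ ≡ v → s e₂ ≡ v → O (s e) ⊆ Hull (O v))
         × (∀ v → t e₁ ≡ v → s e₂ ≡ v →
              (I (t e) ⊆ Hull (I v)) ⊎ (O (s e) ⊆ Hull (O v)))

    U : Set
    U = U₁ × U₂ × U₃

    Q : Set
    Q = Q₁ × Q₂

  LinearOrder : (Edge → Edge → Set) → Set
  LinearOrder _≼_ = IsTotalOrder _≡_ _≼_

-- For a map f (the target or the source map) call f hull-absorbing if
-- whenever e lies in the hull of the fibre f⁻¹(v), the whole fibre of f(e)
-- lies in that hull. Since hulls are convex, the two halves of U₃ say exactly
-- that t and s are hull-absorbing; splitting a hull into the fibre itself and
-- its strict interior shows the same for the first two clauses of Q₂.
-- For U₂, disjointness follows from U₁ (an edge into v precedes every edge out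
-- of v), and an edge strictly between an edge into v and an edge out of v is
-- handled by the third clause of Q₂, which in turn follows from U₂ and U₃.
module Submission where

open import Defs hiding (_⊆_)
open import Data.Fin using (_≟_)
open import Data.Product using (_×_; _,_; Σ; proj₁; proj₂)
open import Data.Sum using (_⊎_; inj₁; inj₂; [_,_]) renaming (map to map-⊎)
open import Data.Empty using (⊥-elim)
open import Function using (_∘_)
open import Relation.Nullary using (yes; no; ¬_)
open import Relation.Binary.PropositionalEquality using (_≡_; refl; sym; cong; subst) renaming (trans to ≡-trans)
open import Relation.Binary.Structures using (IsTotalOrder)

module OrderedDigraph (G : Digraph) (_≼_ : Edge G → Edge G → Set)
                      (≼-totalOrder : LinearOrder G _≼_) where
  open Digraph G
  open Ordered G _≼_
  open IsTotalOrder ≼-totalOrder using (antisym; reflexive) renaming (trans to ≼-trans)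

  infix 4 _⊆_
  _⊆_ : EdgeSet G → EdgeSet G → Set
  _⊆_ = Defs._⊆_ G

  ≼-refl : ∀ {a} → a ≼ a
  ≼-refl = reflexive refl

  ≼⇒≯ : ∀ {a b} → a ≼ b → ¬ b ≺ a
  ≼⇒≯ a≼b (b≼a , b≢a) = b≢a (antisym b≼a a≼b)

  between-cases : ∀ {a y b} → a ≼ y → y ≼ b → y ≡ a ⊎ y ≡ b ⊎ (a ≺ y × y ≺ b)
  between-cases {a} {y} {b} a≼y y≼b with y ≟ a | y ≟ b
  ... | yes y≡a | _       = inj₁ y≡a
  ... | no  _   | yes y≡b = inj₂ (inj₁ y≡b)
  ... | no  y≢a | no  y≢b = inj₂ (inj₂ ((a≼y , y≢a ∘ sym) , (y≼b , y≢b)))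

  StrictHull : EdgeSet G → EdgeSet G
  StrictHull X y = Σ (Edge G) λ a → Σ (Edge G) λ b → X a × X b × a ≺ y × y ≺ b

  ⊆-Hull : ∀ {X} → X ⊆ Hull X
  ⊆-Hull x Xx = x , x , Xx , Xx , ≼-refl , ≼-refl

  Hull-mono : ∀ {X Y} → X ⊆ Y → Hull X ⊆ Hull Y
  Hull-mono X⊆Y y (a , b , Xa , Xb , a≼y , y≼b) = a , b , X⊆Y a Xa , X⊆Y b Xb , a≼y , y≼b

  Hull-least : ∀ {X Y} → X ⊆ Hull Y → Hull X ⊆ Hull Y
  Hull-least X⊆HY y (a , b , Xa , Xb , a≼y , y≼b)
    with X⊆HY a Xa | X⊆HY b Xb
  ... | c , _ , Yc , _ , c≼a , _ | _ , d , _ , Yd , _ , b≼d =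
    c , d , Yc , Yd , ≼-trans c≼a a≼y , ≼-trans y≼b b≼d

  Hull⇒member⊎StrictHull : ∀ {X} → Hull X ⊆ λ y → X y ⊎ StrictHull X y
  Hull⇒member⊎StrictHull {X} y (a , b , Xa , Xb , a≼y , y≼b) with between-cases a≼y y≼b
  ... | inj₁ y≡a                 = inj₁ (subst X (sym y≡a) Xa)
  ... | inj₂ (inj₁ y≡b)          = inj₁ (subst X (sym y≡b) Xb)
  ... | inj₂ (inj₂ (a≺y , y≺b)) = inj₂ (a , b , Xa , Xb , a≺y , y≺b)

  Fibre : (Edge G → Vertex G) → Vertex G → EdgeSet G
  Fibre f v e = f e ≡ v

  HullAbsorbing : (Edge G → Vertex G) → Set
  HullAbsorbing f = ∀ v e → Hull (Fibre f v) e → Fibre f (f e) ⊆ Hull (Fibre f v)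

  StrictHullAbsorbing : (Edge G → Vertex G) → Set
  StrictHullAbsorbing f = ∀ v e → StrictHull (Fibre f v) e → Fibre f (f e) ⊆ Hull (Fibre f v)

  NestedHulls : (Edge G → Vertex G) → Set
  NestedHulls f = ∀ v₁ v₂ → (Σ (Edge G) λ e → Fibre f v₁ e × Hull (Fibre f v₂) e) →
                  Hull (Fibre f v₁) ⊆ Hull (Fibre f v₂)

  NestedHulls⇒HullAbsorbing : ∀ {f} → NestedHulls f → HullAbsorbing f
  NestedHulls⇒HullAbsorbing nested v e e∈H x fx≡fe =
    nested _ v (e , refl , e∈H) x (⊆-Hull x fx≡fe)

  HullAbsorbing⇒NestedHulls : ∀ {f} → HullAbsorbing f → NestedHulls f
  HullAbsorbing⇒NestedHulls {f} absorbing v₁ v₂ (e , fe≡v₁ , e∈H) =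
    Hull-least (subst (λ w → Fibre f w ⊆ Hull (Fibre f v₂)) fe≡v₁ (absorbing v₂ e e∈H))

  StrictHullAbsorbing⇒HullAbsorbing : ∀ {f} → StrictHullAbsorbing f → HullAbsorbing f
  StrictHullAbsorbing⇒HullAbsorbing {f} absorbing v e e∈H
    with Hull⇒member⊎StrictHull e e∈H
  ... | inj₁ fe≡v     = subst (λ w → Fibre f w ⊆ Hull (Fibre f v)) (sym fe≡v) ⊆-Hull
  ... | inj₂ e∈Strict = absorbing v e e∈Strict

  U₃⇒NestedHulls : U₃ → NestedHulls t × NestedHulls s
  U₃⇒NestedHulls u₃ = (λ v₁ v₂ → proj₁ (u₃ v₁ v₂)) , (λ v₁ v₂ → proj₂ (u₃ v₁ v₂))

  NestedHulls⇒U₃ : NestedHulls t → NestedHulls s → U₃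
  NestedHulls⇒U₃ nested-t nested-s v₁ v₂ = nested-t v₁ v₂ , nested-s v₁ v₂

  Q₂⇒StrictHullAbsorbing : Q₂ → StrictHullAbsorbing t × StrictHullAbsorbing s
  Q₂⇒StrictHullAbsorbing q₂ =
      (λ v e (a , b , ta , tb , a≺e , e≺b) → proj₁ (q₂ a e b a≺e e≺b) v ta tb)
    , (λ v e (a , b , sa , sb , a≺e , e≺b) → proj₁ (proj₂ (q₂ a e b a≺e e≺b)) v sa sb)

  into≺out : U₁ → ∀ {v a b} → I G v a → O G v b → a ≺ b
  into≺out u₁ {a = a} {b} ta sb = u₁ a b (step (≡-trans ta (sym sb)))

  Hulls-disjoint : U₁ → ∀ v e → ¬ (Hull (I G v) e × Hull (O G v) e)
  Hulls-disjoint u₁ v e ((_ , b , _ , tb , _ , e≼b) , (c , _ , sc , _ , c≼e , _)) =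
    ≼⇒≯ (≼-trans c≼e e≼b) (into≺out u₁ tb sc)

  Hull-into∪out : Q → ∀ v → Hull (E G v) ⊆ λ e → Hull (I G v) e ⊎ Hull (O G v) e
  Hull-into∪out (q₁ , q₂) v e (a , b , inj₁ ta , inj₁ tb , a≼e , e≼b) = inj₁ (a , b , ta , tb , a≼e , e≼b)
  Hull-into∪out (q₁ , q₂) v e (a , b , inj₂ sa , inj₂ sb , a≼e , e≼b) = inj₂ (a , b , sa , sb , a≼e , e≼b)
  Hull-into∪out (q₁ , q₂) v e (a , b , inj₂ sa , inj₁ tb , a≼e , e≼b) =
    ⊥-elim (≼⇒≯ (≼-trans a≼e e≼b) (into≺out q₁ tb sa))
  Hull-into∪out (q₁ , q₂) v e (a , b , inj₁ ta , inj₂ sb , a≼e , e≼b) with between-cases a≼e e≼b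
  ... | inj₁ e≡a                 = inj₁ (⊆-Hull e (≡-trans (cong t e≡a) ta))
  ... | inj₂ (inj₁ e≡b)          = inj₂ (⊆-Hull e (≡-trans (cong s e≡b) sb))
  ... | inj₂ (inj₂ (a≺e , e≺b)) =
    map-⊎ (λ into⊆ → into⊆ e refl) (λ out⊆ → out⊆ e refl) (proj₂ (proj₂ (q₂ a e b a≺e e≺b)) v ta sb)

  U⇒Q : U → Q
  U⇒Q (u₁ , u₂ , u₃) = u₁ , q₂
    where
    absorbing-t : HullAbsorbing t
    absorbing-t = NestedHulls⇒HullAbsorbing (proj₁ (U₃⇒NestedHulls u₃))
    absorbing-s : HullAbsorbing s
    absorbing-s = NestedHulls⇒HullAbsorbing (proj₂ (U₃⇒NestedHulls u₃))
    q₂ : Q₂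
    q₂ e₁ e e₂ (e₁≼e , _) (e≼e₂ , _) =
        (λ v te₁ te₂ → absorbing-t v e (e₁ , e₂ , te₁ , te₂ , e₁≼e , e≼e₂))
      , (λ v se₁ se₂ → absorbing-s v e (e₁ , e₂ , se₁ , se₂ , e₁≼e , e≼e₂))
      , λ v te₁ se₂ → map-⊎ (absorbing-t v e) (absorbing-s v e)
                            (proj₁ (proj₂ (u₂ v)) e (e₁ , e₂ , inj₁ te₁ , inj₂ se₂ , e₁≼e , e≼e₂))

  Q⇒U : Q → U
  Q⇒U (q₁ , q₂) = q₁ , u₂ , NestedHulls⇒U₃ (nested strict-t) (nested strict-s)
    where
    strict-t : StrictHullAbsorbing t
    strict-t = proj₁ (Q₂⇒StrictHullAbsorbing q₂)
    strict-s : StrictHullAbsorbing s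
    strict-s = proj₂ (Q₂⇒StrictHullAbsorbing q₂)
    nested : ∀ {f} → StrictHullAbsorbing f → NestedHulls f
    nested = HullAbsorbing⇒NestedHulls ∘ StrictHullAbsorbing⇒HullAbsorbing
    u₂ : U₂
    u₂ v = Hulls-disjoint q₁ v
         , Hull-into∪out (q₁ , q₂) v
         , λ e → [ Hull-mono (λ _ → inj₁) e , Hull-mono (λ _ → inj₂) e ]

theorem2p4 : (G : Digraph) → Acyclic G →
    (_≼_ : Edge G → Edge G → Set) → LinearOrder G _≼_ →
    ((Ordered.U G _≼_ → Ordered.Q G _≼_) × (Ordered.Q G _≼_ → Ordered.U G _≼_))
theorem2p4 G _ _≼_ ≼-totalOrder = U⇒Q , Q⇒U
  where open OrderedDigraph G _≼_ ≼-totalOrder
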